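{- Let $X$ be an $M\times N$ matrix in which any two entries in the same column are distinct. Let $S$ be a set of positions of $X$ such that $X_a=X_b$ for all $a,b\in S$ with $a$ strictly to the left of and strictly above $b$. Then $|S|\le M+2N$. -}

module Defs where

open import Data.Nat using (ℕ)
open import Data.Fin using (Fin; _<_)
open import Data.Product using (_×_; _,_)
open import Data.List using (List)
open import Data.List.Membership.Propositional using (_∈_)
open import Relation.Binary.PropositionalEquality using (_≡_)

Matrix : Set → ℕ → ℕ → Set
Matrix A M N = Fin M → Fin N → A

Pos : ℕ → ℕ → Set
Pos M N = Fin M × Fin N

ColumnDistinct : {A : Set} {M N : ℕ} → Matrix A M N → Set
ColumnDistinct {M = M} {N = N} X =
  (j : Fin N) (i i′ : Fin M) → X i j ≡ X i′ j → i ≡ i′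

entry : {A : Set} {M N : ℕ} → Matrix A M N → Pos M N → A
entry X (i , j) = X i j

StrictlyAboveLeft : {M N : ℕ} → Pos M N → Pos M N → Set
StrictlyAboveLeft (i , j) (i′ , j′) = (i < i′) × (j < j′)

-- The condition on the set S of positions (S given as a duplicate-free list).
GoodSet : {A : Set} {M N : ℕ} → Matrix A M N → List (Pos M N) → Set
GoodSet {M = M} {N = N} X S =
  (a b : Pos M N) → a ∈ S → b ∈ S → StrictlyAboveLeft a b → entry X a ≡ entry X b

-- Sort the points of S by their position within their column of S: topmost, bottommost,
-- or interior (points of S both above and below).  Each column has at most one topmost and
-- one bottommost point.  Each row has at most one interior point: if (i , j) and (i , j′),
-- j < j′, were both interior, take a ∈ S above (i , j) and b ∈ S below (i , j′); then
-- X a = X (i , j′) and X a = X b, two distinct entries of column j′.  So S injects into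
-- M + 2N slots.
module Submission where

open import Defs
open import Data.Nat using (ℕ; _≤_; _+_; _*_)
open import Data.List using (List; length; lookup)
open import Data.List.Relation.Unary.Unique.Propositional using (Unique)

open import Data.Empty using (⊥; ⊥-elim)
open import Data.Fin using (Fin; zero; suc; _<_)
open import Data.Fin.Properties using (_≟_; _<?_; <-cmp; <-irrefl; <-trans; injective⇒≤; +↔⊎; *↔×)
open import Data.List.Membership.Propositional using (_∈_; find; lose)
open import Data.List.Membership.Propositional.Properties using (∈-lookup)
open import Data.List.Relation.Unary.All as All using ()
open import Data.List.Relation.Unary.AllPairs using (_∷_)
open import Data.List.Relation.Unary.Any using (Any; any?)
open import Data.Product using (_×_; _,_)
open import Data.Sum using (_⊎_; inj₁; inj₂)
open import Data.Sum.Function.Propositional using (_⊎-↔_)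
open import Function using (_∘_; _↣_; Injection)
open import Function.Properties.Inverse using (↔-refl; ↔-sym; ↔-trans; Inverse⇒Injection)
open import Relation.Binary using (Decidable; tri<; tri≈; tri>)
open import Relation.Binary.PropositionalEquality using (_≡_; refl; sym; trans; cong)
open import Relation.Nullary using (¬_; yes; no)
open import Relation.Nullary.Decidable using (_×-dec_)

lookup-injective : ∀ {A : Set} {xs : List A} → Unique xs →
                   ∀ {i j} → lookup xs i ≡ lookup xs j → i ≡ j
lookup-injective (_ ∷ _)     {zero}  {zero}  _  = refl
lookup-injective (x∉xs ∷ _) {zero}  {suc j} eq = ⊥-elim (All.lookup x∉xs (∈-lookup j) eq)
lookup-injective (x∉xs ∷ _) {suc i} {zero}  eq = ⊥-elim (All.lookup x∉xs (∈-lookup i) (sym eq))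
lookup-injective (_ ∷ u)     {suc i} {suc j} eq = cong suc (lookup-injective u eq)

length-≤-of-injectiveOn : ∀ {A : Set} {K : ℕ} {xs : List A} (f : A → Fin K) →
                          (∀ {x y} → x ∈ xs → y ∈ xs → f x ≡ f y → x ≡ y) →
                          Unique xs → length xs ≤ K
length-≤-of-injectiveOn f f-injectiveOn unique =
  injective⇒≤ (lookup-injective unique ∘ f-injectiveOn (∈-lookup _) (∈-lookup _))

_Above_ : ∀ {M N} → Pos M N → Pos M N → Set
(r , c) Above (i , j) = c ≡ j × r < i

_above?_ : ∀ {M N} → Decidable (_Above_ {M} {N})
(r , c) above? (i , j) = (c ≟ j) ×-dec (r <? i)

-- inj₁ i: the interior point of row i; inj₂ (0 , j) / inj₂ (1 , j): top / bottom of column j.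
Slot : ℕ → ℕ → Set
Slot M N = Fin M ⊎ Fin 2 × Fin N

slotIndex : ∀ {M N} → Slot M N ↣ Fin (M + 2 * N)
slotIndex = Inverse⇒Injection (↔-sym (↔-trans +↔⊎ (↔-refl ⊎-↔ *↔×)))

module _ {M N : ℕ} (S : List (Pos M N)) where

  HasAbove HasBelow : Pos M N → Set
  HasAbove p = Any (_Above p) S
  HasBelow p = Any (p Above_) S

  data Kind (p : Pos M N) : Set where
    topmost    : ¬ HasAbove p → Kind p
    bottommost : HasAbove p → ¬ HasBelow p → Kind p
    interior   : HasAbove p → HasBelow p → Kind p

  kind : (p : Pos M N) → Kind p
  kind p with any? (_above? p) S | any? (p above?_) S
  ... | no ¬above | _         = topmost ¬above
  ... | yes above | no ¬below = bottommost above ¬below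
  ... | yes above | yes below = interior above below

  slotOf : ∀ {p} → Kind p → Slot M N
  slotOf {_ , j} (topmost _)      = inj₂ (zero , j)
  slotOf {_ , j} (bottommost _ _) = inj₂ (suc zero , j)
  slotOf {i , _} (interior _ _)   = inj₁ i

  slot : Pos M N → Slot M N
  slot p = slotOf (kind p)

  topmost-unique : ∀ {i i′ j} → (i , j) ∈ S → (i′ , j) ∈ S →
                   ¬ HasAbove (i , j) → ¬ HasAbove (i′ , j) → (i , j) ≡ (i′ , j)
  topmost-unique {i} {i′} p∈S q∈S ¬p-above ¬q-above with <-cmp i i′
  ... | tri< i<i′ _ _ = ⊥-elim (¬q-above (lose p∈S (refl , i<i′)))
  ... | tri≈ _ refl _ = refl
  ... | tri> _ _ i′<i = ⊥-elim (¬p-above (lose q∈S (refl , i′<i)))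

  bottommost-unique : ∀ {i i′ j} → (i , j) ∈ S → (i′ , j) ∈ S →
                      ¬ HasBelow (i , j) → ¬ HasBelow (i′ , j) → (i , j) ≡ (i′ , j)
  bottommost-unique {i} {i′} p∈S q∈S ¬p-below ¬q-below with <-cmp i i′
  ... | tri< i<i′ _ _ = ⊥-elim (¬p-below (lose q∈S (refl , i<i′)))
  ... | tri≈ _ refl _ = refl
  ... | tri> _ _ i′<i = ⊥-elim (¬q-below (lose p∈S (refl , i′<i)))

  module _ {A : Set} {X : Matrix A M N} (distinct : ColumnDistinct X) (good : GoodSet X S) where

    above-left-below-right-absurd : ∀ {i j j′} → (i , j′) ∈ S → j < j′ →
                                    HasAbove (i , j) → HasBelow (i , j′) → ⊥
    above-left-below-right-absurd {i} {j} {j′} q∈S j<j′ above below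
      with find above | find below
    ... | (r , .j) , a∈S , refl , r<i | (r′ , .j′) , b∈S , refl , i<r′ =
      <-irrefl (distinct j′ i r′ (trans (sym Xa≡Xq) Xa≡Xb)) i<r′
      where
      Xa≡Xq : X r j ≡ X i j′
      Xa≡Xq = good (r , j) (i , j′) a∈S q∈S (r<i , j<j′)
      Xa≡Xb : X r j ≡ X r′ j′
      Xa≡Xb = good (r , j) (r′ , j′) a∈S b∈S (<-trans r<i i<r′ , j<j′)

    interior-unique : ∀ {i j j′} → (i , j) ∈ S → (i , j′) ∈ S →
                      HasAbove (i , j) → HasBelow (i , j) →
                      HasAbove (i , j′) → HasBelow (i , j′) → (i , j) ≡ (i , j′)
    interior-unique {i} {j} {j′} p∈S q∈S p-above p-below q-above q-below with <-cmp j j′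
    ... | tri< j<j′ _ _ = ⊥-elim (above-left-below-right-absurd q∈S j<j′ p-above q-below)
    ... | tri≈ _ refl _ = refl
    ... | tri> _ _ j′<j = ⊥-elim (above-left-below-right-absurd p∈S j′<j q-above p-below)

    slotOf-injective : ∀ {p q} → p ∈ S → q ∈ S → (k : Kind p) (l : Kind q) →
                       slotOf k ≡ slotOf l → p ≡ q
    slotOf-injective p∈S q∈S (topmost ¬a) (topmost ¬a′) refl =
      topmost-unique p∈S q∈S ¬a ¬a′
    slotOf-injective p∈S q∈S (bottommost _ ¬b) (bottommost _ ¬b′) refl =
      bottommost-unique p∈S q∈S ¬b ¬b′
    slotOf-injective p∈S q∈S (interior a b) (interior a′ b′) refl =
      interior-unique p∈S q∈S a b a′ b′
    slotOf-injective _ _ (topmost _)      (bottommost _ _) ()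
    slotOf-injective _ _ (topmost _)      (interior _ _)   ()
    slotOf-injective _ _ (bottommost _ _) (topmost _)      ()
    slotOf-injective _ _ (bottommost _ _) (interior _ _)   ()
    slotOf-injective _ _ (interior _ _)   (topmost _)      ()
    slotOf-injective _ _ (interior _ _)   (bottommost _ _) ()

    slot-injectiveOn : ∀ {p q} → p ∈ S → q ∈ S → slot p ≡ slot q → p ≡ q
    slot-injectiveOn {p} {q} p∈S q∈S = slotOf-injective p∈S q∈S (kind p) (kind q)

lemma8 : {A : Set} (M N : ℕ) (X : Matrix A M N) → ColumnDistinct X
       → (S : List (Pos M N)) → Unique S → GoodSet X S
       → length S ≤ M + 2 * N
lemma8 M N X distinct S unique good =
  length-≤-of-injectiveOn (to ∘ slot S)
    (λ p∈S q∈S → slot-injectiveOn S distinct good p∈S q∈S ∘ injective)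
    unique
  where open Injection slotIndex
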